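{- Every ${}^\infty$-algebra $(K,+,\cdot,{}^\infty,0,1)$ satisfies, for all $a,b,c\in K$: if $ac\le bc$ then $a^\infty c\le b^\infty c$.
   Context: An ${}^\infty$-algebra is a structure $(K,+,\cdot,{}^\infty,0,1)$ such that $(K,+,\cdot,0,1)$ is an absorptive commutative semiring (i.e. $1+a=1$ for all $a$) and the unary operation ${}^\infty$ satisfies $a^\infty=a\,a^\infty$ and the implication $b\le c+ab\ \Rightarrow\ b\le c+a^\infty b$ for all $a,b,c$, where $\le$ is the natural order ($x\le y$ iff $x+y=y$). -}

module Defs where

open import Level using (Level; suc; _⊔_)
open import Algebra.Bundles using (CommutativeSemiring)

record InftyAlgebra (c ℓ : Level) : Set (suc (c ⊔ ℓ)) where
  field
    commutativeSemiring : CommutativeSemiring c ℓ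

  open CommutativeSemiring commutativeSemiring public

  infix 4 _≤_
  _≤_ : Carrier → Carrier → Set ℓ
  x ≤ y = (x + y) ≈ y

  infix 10 _^∞
  field
    _^∞        : Carrier → Carrier
    absorptive : ∀ a → (1# + a) ≈ 1#
    ∞-unfold   : ∀ a → (a ^∞) ≈ (a * (a ^∞))
    ∞-induct   : ∀ a b c → b ≤ c + a * b → b ≤ c + (a ^∞) * b

-- Put x = a^∞ c. Unfolding a^∞ and using a c ≤ b c gives x = a x ≤ b x, so
-- the induction rule for b^∞ yields x ≤ b^∞ x. Absorptivity makes every
-- element at most 1, hence x ≤ c and b^∞ x ≤ b^∞ c.
module Submission where

open import Defs
open import Level using (Level; _⊔_)
open import Algebra.Bundles using (Semiring)
import Algebra.Properties.CommutativeSemigroup as CommutativeSemigroupProperties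
open import Relation.Binary.Bundles using (Preorder)
open import Relation.Binary.Structures using (IsPreorder)
import Relation.Binary.Reasoning.Preorder as PreorderReasoning
import Relation.Binary.Reasoning.Setoid as SetoidReasoning

module NaturalOrder {c ℓ : Level} (R : Semiring c ℓ) where
  open Semiring R
  open SetoidReasoning setoid

  infix 4 _≤_
  _≤_ : Carrier → Carrier → Set ℓ
  x ≤ y = x + y ≈ y

  ≤-trans : ∀ {x y z} → x ≤ y → y ≤ z → x ≤ z
  ≤-trans {x} {y} {z} x≤y y≤z = begin
    x + z        ≈⟨ +-congˡ y≤z ⟨
    x + (y + z)  ≈⟨ +-assoc x y z ⟨
    (x + y) + z  ≈⟨ +-congʳ x≤y ⟩
    y + z        ≈⟨ y≤z ⟩
    z            ∎

  *-monoʳ-≤ : ∀ z {x y} → x ≤ y → z * x ≤ z * y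
  *-monoʳ-≤ z {x} {y} x≤y = begin
    z * x + z * y  ≈⟨ distribˡ z x y ⟨
    z * (x + y)    ≈⟨ *-congˡ x≤y ⟩
    z * y          ∎

  *-monoˡ-≤ : ∀ z {x y} → x ≤ y → x * z ≤ y * z
  *-monoˡ-≤ z {x} {y} x≤y = begin
    x * z + y * z  ≈⟨ distribʳ z x y ⟨
    (x + y) * z    ≈⟨ *-congʳ x≤y ⟩
    y * z          ∎

Absorptive : {c ℓ : Level} → Semiring c ℓ → Set (c ⊔ ℓ)
Absorptive R = ∀ a → 1# + a ≈ 1#
  where open Semiring R

module AbsorptiveOrder {c ℓ : Level} (R : Semiring c ℓ) (absorptive : Absorptive R) where
  open Semiring R
  open NaturalOrder R public

  +-idem : ∀ x → x + x ≈ x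
  +-idem x = begin
    x + x            ≈⟨ +-cong (*-identityʳ x) (*-identityʳ x) ⟨
    x * 1# + x * 1#  ≈⟨ distribˡ x 1# 1# ⟨
    x * (1# + 1#)    ≈⟨ *-congˡ (absorptive 1#) ⟩
    x * 1#           ≈⟨ *-identityʳ x ⟩
    x                ∎
    where open SetoidReasoning setoid

  ≤-reflexive : ∀ {x y} → x ≈ y → x ≤ y
  ≤-reflexive {x} {y} x≈y = trans (+-congʳ x≈y) (+-idem y)

  ≤-isPreorder : IsPreorder _≈_ _≤_
  ≤-isPreorder = record
    { isEquivalence = isEquivalence
    ; reflexive     = ≤-reflexive
    ; trans         = ≤-trans
    }

  open IsPreorder ≤-isPreorder public
    using () renaming (≲-respʳ-≈ to ≤-respʳ-≈)

  ≤-preorder : Preorder c ℓ ℓ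
  ≤-preorder = record { isPreorder = ≤-isPreorder }

  module ≤-Reasoning = PreorderReasoning ≤-preorder

  x≤1 : ∀ x → x ≤ 1#
  x≤1 x = trans (+-comm x 1#) (absorptive x)

  x*y≤y : ∀ x y → x * y ≤ y
  x*y≤y x y = begin
    x * y   ≲⟨ *-monoˡ-≤ y (x≤1 x) ⟩
    1# * y  ≈⟨ *-identityˡ y ⟩
    y       ∎
    where open ≤-Reasoning

module InftyAlgebraProperties {c ℓ : Level} (K : InftyAlgebra c ℓ) where
  open InftyAlgebra K
  open AbsorptiveOrder semiring absorptive public
    using (*-monoʳ-≤; x*y≤y; module ≤-Reasoning)
  open AbsorptiveOrder semiring absorptive using (≤-respʳ-≈)

  ^∞*-unfold : ∀ a c → a ^∞ * c ≈ a * (a ^∞ * c)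
  ^∞*-unfold a c = trans (*-congʳ (∞-unfold a)) (*-assoc a (a ^∞) c)

  ∞-induct₀ : ∀ a b → b ≤ a * b → b ≤ a ^∞ * b
  ∞-induct₀ a b b≤ab = ≤-respʳ-≈ (+-identityˡ _)
    (∞-induct a b 0# (≤-respʳ-≈ (sym (+-identityˡ _)) b≤ab))

lemmaB3 : {ℓc ℓ : Level} (K : InftyAlgebra ℓc ℓ) →
    let open InftyAlgebra K in
    ∀ a b c → a * c ≤ b * c → (a ^∞) * c ≤ (b ^∞) * c
lemmaB3 K a b c ac≤bc = begin
  a ^∞ * c              ≲⟨ ∞-induct₀ b (a ^∞ * c) a^∞c≤b·a^∞c ⟩
  b ^∞ * (a ^∞ * c)     ≲⟨ *-monoʳ-≤ (b ^∞) (x*y≤y (a ^∞) c) ⟩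
  b ^∞ * c              ∎
  where
  open InftyAlgebra K
  open InftyAlgebraProperties K
  open CommutativeSemigroupProperties *-commutativeSemigroup using (x∙yz≈y∙xz)
  open ≤-Reasoning

  a^∞c≤b·a^∞c : a ^∞ * c ≤ b * (a ^∞ * c)
  a^∞c≤b·a^∞c = begin
    a ^∞ * c            ≈⟨ ^∞*-unfold a c ⟩
    a * (a ^∞ * c)      ≈⟨ x∙yz≈y∙xz a (a ^∞) c ⟩
    a ^∞ * (a * c)      ≲⟨ *-monoʳ-≤ (a ^∞) ac≤bc ⟩
    a ^∞ * (b * c)      ≈⟨ x∙yz≈y∙xz (a ^∞) b c ⟩
    b * (a ^∞ * c)      ∎
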